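{- Let $G$ be a left-compressed $3$-graph on the vertex set $[t]$ with $m$ edges. If $G$ does not contain a clique of order $4$, then $m\le \frac{2}{27}t^3$.
   Context: A $3$-graph $G$ on vertex set $[t]=\{1,\dots,t\}$ has an edge set $E$ of $3$-element subsets of $[t]$; an edge $\{a,b,c\}$ is written $abc$. $G$ is left-compressed if whenever $j_1j_2j_3\in E$ and $i_1,i_2,i_3$ are distinct with $i_p\le j_p$ for $p=1,2,3$, then $i_1i_2i_3\in E$. A clique of order $4$ is a set of $4$ vertices all of whose $3$-subsets are edges of $G$. -}

module Defs where

open import Data.Nat using (ℕ; _<_; _≤_)
open import Data.Fin using (Fin; toℕ)
open import Data.Product using (_×_; _,_)
open import Data.Sum using (_⊎_)
open import Data.Empty using (⊥)
open import Data.List using (List; length)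
open import Data.List.Relation.Unary.All using (All)
open import Data.List.Relation.Unary.Unique.Propositional using (Unique)
open import Data.List.Membership.Propositional using (_∈_)
open import Relation.Binary.PropositionalEquality using (_≢_)

-- Vertex set [t] is represented by Fin t (vertex i+1 ↦ i; order preserved).
Vertex : ℕ → Set
Vertex t = Fin t

-- A triple (a , b , c) written in increasing order represents the edge abc.
Triple : ℕ → Set
Triple t = Vertex t × Vertex t × Vertex t

Sorted : ∀ {t} → Triple t → Set
Sorted (a , b , c) = toℕ a < toℕ b × toℕ b < toℕ c

record ThreeGraph (t : ℕ) : Set where
  constructor mk3graph
  field
    edges  : List (Triple t)
    sorted : All Sorted edges
    unique : Unique edges
open ThreeGraph public

numEdges : ∀ {t} → ThreeGraph t → ℕ
numEdges G = length (edges G)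

IsEdge : ∀ {t} → ThreeGraph t → Vertex t → Vertex t → Vertex t → Set
IsEdge G a b c =
  ((a , b , c) ∈ edges G) ⊎ ((a , c , b) ∈ edges G) ⊎ ((b , a , c) ∈ edges G) ⊎
  ((b , c , a) ∈ edges G) ⊎ ((c , a , b) ∈ edges G) ⊎ ((c , b , a) ∈ edges G)

Distinct3 : ∀ {t} → Vertex t → Vertex t → Vertex t → Set
Distinct3 a b c = (a ≢ b) × (a ≢ c) × (b ≢ c)

LeftCompressed : ∀ {t} → ThreeGraph t → Set
LeftCompressed {t} G =
  ∀ (i₁ i₂ i₃ j₁ j₂ j₃ : Vertex t) →
  IsEdge G j₁ j₂ j₃ → Distinct3 i₁ i₂ i₃ →
  toℕ i₁ ≤ toℕ j₁ → toℕ i₂ ≤ toℕ j₂ → toℕ i₃ ≤ toℕ j₃ →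
  IsEdge G i₁ i₂ i₃

Clique4 : ∀ {t} → ThreeGraph t → Vertex t → Vertex t → Vertex t → Vertex t → Set
Clique4 G a b c d =
  Distinct3 a b c × (a ≢ d) × (b ≢ d) × (c ≢ d) ×
  IsEdge G a b c × IsEdge G a b d × IsEdge G a c d × IsEdge G b c d

K4Free : ∀ {t} → ThreeGraph t → Set
K4Free {t} G = ∀ (a b c d : Vertex t) → Clique4 G a b c d → ⊥

module Submission where

-- Number the vertices 0,1,…,t-1.  In a left-compressed K₄-free
-- 3-graph every edge contains the vertex 0: an edge abc with 0 < a < b < c
-- dominates 12c coordinatewise, so 12c is an edge, and compressing 12c gives
-- the edges 012, 01c and 02c as well; then {0,1,2,c} is a clique of order 4.
-- Hence the edges lie among the C(t-1,2) triples {0,b,c} with 0 < b < c, and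
-- since the edge list has no repetitions, m ≤ C(t-1,2) ≤ (t-1)²/2.  Finally
-- 27(t-1)² ≤ 4t³ is the AM-GM inequality for (t-1)/2, (t-1)/2, 1; in ℕ it is
-- the identity 4(k+3)³ = 27(k+2)² + k²(4k+9).

open import Defs
open import Data.Nat using (ℕ; zero; suc; _+_; _*_; _^_; _≤_; _<_; z≤n; s≤s)
open import Data.Nat.Properties
  using (≤-refl; ≤-trans; m≤m+n; n≤1+n; +-monoʳ-≤; *-monoʳ-≤; *-cancelˡ-≤; *-assoc; *-distribˡ-+; module ≤-Reasoning)
open import Data.Nat.Tactic.RingSolver using (solve-∀)
open import Data.Fin using (Fin; toℕ) renaming (zero to fz; suc to fs)
open import Data.Product using (_×_; _,_)
import Data.Product as Product
open import Data.Sum using (inj₁)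
open import Data.Empty using (⊥; ⊥-elim)
open import Data.List using (List; []; _∷_; length; map; _++_; allFin)
open import Data.List.Properties using (length-map; length-++; length-tabulate; length-removeAt′)
open import Data.List.Relation.Unary.All as All using ()
open import Data.List.Relation.Unary.Any using (here; there; _─_)
open import Data.List.Relation.Unary.AllPairs using (_∷_)
open import Data.List.Relation.Unary.Unique.Propositional using (Unique)
open import Data.List.Membership.Propositional using (_∈_)
open import Data.List.Membership.Propositional.Properties using (∈-map⁺; ∈-++⁺ˡ; ∈-++⁺ʳ; ∈-allFin)
open import Data.List.Relation.Binary.Subset.Propositional using (_⊆_)
open import Relation.Binary.PropositionalEquality using (_≡_; _≢_; refl; sym; cong; cong₂; trans; subst; module ≡-Reasoning)

module _ {A : Set} where

  ∈-─ : {x y : A} (ys : List A) → y ∈ ys → (x∈ys : x ∈ ys) → y ≢ x → y ∈ (ys ─ x∈ys)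
  ∈-─ (z ∷ ys) (here refl) (here refl) y≢x = ⊥-elim (y≢x refl)
  ∈-─ (z ∷ ys) (here refl) (there _)   y≢x = here refl
  ∈-─ (z ∷ ys) (there y∈ys) (here refl) y≢x = y∈ys
  ∈-─ (z ∷ ys) (there y∈ys) (there x∈ys) y≢x = there (∈-─ ys y∈ys x∈ys y≢x)

  unique-⊆-length : (xs ys : List A) → Unique xs → xs ⊆ ys → length xs ≤ length ys
  unique-⊆-length []       ys _                 _   = z≤n
  unique-⊆-length (x ∷ xs) ys (x∉xs ∷ xs-unique) xs⊆ys =
    subst (suc (length xs) ≤_) (sym (length-removeAt′ ys _))
      (s≤s (unique-⊆-length xs (ys ─ x∈ys) xs-unique xs⊆ys─x))
    where
      x∈ys : x ∈ ys
      x∈ys = xs⊆ys (here refl)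
      xs⊆ys─x : xs ⊆ (ys ─ x∈ys)
      xs⊆ys─x y∈xs = ∈-─ ys (xs⊆ys (there y∈xs)) x∈ys (λ y≡x → All.lookup x∉xs y∈xs (sym y≡x))

increasingPairs : (n : ℕ) → List (Fin n × Fin n)
increasingPairs zero    = []
increasingPairs (suc n) =
  map (λ c → (fz , fs c)) (allFin n) ++ map (Product.map fs fs) (increasingPairs n)

increasingPairs-complete : (n : ℕ) (b c : Fin n) → toℕ b < toℕ c → (b , c) ∈ increasingPairs n
increasingPairs-complete (suc n) fz     (fs c) _ = ∈-++⁺ˡ (∈-map⁺ (λ c → (fz , fs c)) (∈-allFin c))
increasingPairs-complete (suc n) (fs b) (fs c) (s≤s b<c) =
  ∈-++⁺ʳ (map (λ c → (fz , fs c)) (allFin n))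
         (∈-map⁺ (Product.map fs fs) (increasingPairs-complete n b c b<c))

length-increasingPairs-suc : (n : ℕ) →
  length (increasingPairs (suc n)) ≡ n + length (increasingPairs n)
length-increasingPairs-suc n = begin
  length (increasingPairs (suc n))
    ≡⟨ length-++ (map (λ c → (fz , fs c)) (allFin n)) ⟩
  length (map (λ c → (fz , fs c)) (allFin n)) + length (map (Product.map fs fs) (increasingPairs n))
    ≡⟨ cong₂ _+_ (trans (length-map _ (allFin n)) (length-tabulate (λ c → c)))
                 (length-map _ (increasingPairs n)) ⟩
  n + length (increasingPairs n) ∎
  where open ≡-Reasoning

-- Each increasing pair {b , c} of Fin n corresponds to two of the n² ordered
-- pairs, so twice their number is at most n².
increasingPairs-bound : (n : ℕ) → 2 * length (increasingPairs n) ≤ n * n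
increasingPairs-bound zero    = z≤n
increasingPairs-bound (suc n) = begin
  2 * length (increasingPairs (suc n)) ≡⟨ cong (2 *_) (length-increasingPairs-suc n) ⟩
  2 * (n + P)                         ≡⟨ *-distribˡ-+ 2 n P ⟩
  2 * n + 2 * P                       ≤⟨ +-monoʳ-≤ (2 * n) (increasingPairs-bound n) ⟩
  2 * n + n * n                       ≤⟨ n≤1+n _ ⟩
  suc (2 * n + n * n)                 ≡⟨ square-suc n ⟩
  suc n * suc n                       ∎
  where
    open ≤-Reasoning
    P : ℕ
    P = length (increasingPairs n)
    square-suc : ∀ m → suc (2 * m + m * m) ≡ suc m * suc m
    square-suc = solve-∀

-- AM-GM for (n/2, n/2, 1): 27 n² ≤ 4 (n+1)³, with equality at n = 2.  For
-- n = k + 2 the difference is k²(4k+9).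
am-gm : (n : ℕ) → 27 * (n * n) ≤ 4 * suc n ^ 3
am-gm zero          = z≤n
am-gm (suc zero)    = m≤m+n 27 5
am-gm (suc (suc k)) =
  subst (27 * (n * n) ≤_) (sym (cube-expansion k)) (m≤m+n (27 * (n * n)) (k * k * (4 * k + 9)))
  where
    n : ℕ
    n = suc (suc k)
    -- (3 + j) ^ 3 unfolds definitionally to the product below.
    cube-expansion : ∀ j → 4 * ((3 + j) * ((3 + j) * ((3 + j) * 1))) ≡ 27 * ((2 + j) * (2 + j)) + j * j * (4 * j + 9)
    cube-expansion = solve-∀

increasingPairs-cubic-bound : (n : ℕ) → 27 * length (increasingPairs n) ≤ 2 * suc n ^ 3
increasingPairs-cubic-bound n = *-cancelˡ-≤ 2 (begin
  2 * (27 * P)      ≡⟨ reassociate P ⟩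
  27 * (2 * P)      ≤⟨ *-monoʳ-≤ 27 (increasingPairs-bound n) ⟩
  27 * (n * n)      ≤⟨ am-gm n ⟩
  4 * suc n ^ 3     ≡⟨ *-assoc 2 2 (suc n ^ 3) ⟩
  2 * (2 * suc n ^ 3) ∎)
  where
    open ≤-Reasoning
    P : ℕ
    P = length (increasingPairs n)
    reassociate : ∀ p → 2 * (27 * p) ≡ 27 * (2 * p)
    reassociate = solve-∀

triplesThrough0 : (t : ℕ) → List (Triple t)
triplesThrough0 zero    = []
triplesThrough0 (suc n) = map (λ (b , c) → (fz , fs b , fs c)) (increasingPairs n)

triplesThrough0-bound : (t : ℕ) → 27 * length (triplesThrough0 t) ≤ 2 * t ^ 3
triplesThrough0-bound zero    = z≤n
triplesThrough0-bound (suc n) =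
  subst (λ m → 27 * m ≤ 2 * suc n ^ 3) (sym (length-map _ (increasingPairs n)))
    (increasingPairs-cubic-bound n)

-- Such an edge dominates 12c, and 12c in turn
-- dominates 012, 01c and 02c, so {0,1,2,c} would be a clique of order 4.
no-edge-avoiding-0 : ∀ {t} (G : ThreeGraph t) → LeftCompressed G → K4Free G →
  (a b c : Vertex t) → 1 ≤ toℕ a → 2 ≤ toℕ b → 3 ≤ toℕ c → IsEdge G a b c → ⊥
no-edge-avoiding-0 G lc k4free a b fz _ _ () _
no-edge-avoiding-0 G lc k4free a b (fs fz) _ _ (s≤s ()) _
no-edge-avoiding-0 G lc k4free a b (fs (fs fz)) _ _ (s≤s (s≤s ())) _
no-edge-avoiding-0 {suc (suc (suc t))} G lc k4free a b (fs (fs (fs c))) 1≤a 2≤b _ abc =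
  k4free v0 v1 v2 v (((λ ()) , (λ ()) , (λ ())) , (λ ()) , (λ ()) , (λ ()) , e012 , e01v , e02v , e12v)
  where
    v0 v1 v2 v : Vertex (suc (suc (suc t)))
    v0 = fz
    v1 = fs fz
    v2 = fs (fs fz)
    v  = fs (fs (fs c))
    e12v : IsEdge G v1 v2 v
    e12v = lc v1 v2 v a b v abc ((λ ()) , (λ ()) , (λ ())) 1≤a 2≤b ≤-refl
    e012 : IsEdge G v0 v1 v2
    e012 = lc v0 v1 v2 v1 v2 v e12v ((λ ()) , (λ ()) , (λ ())) z≤n (s≤s z≤n) (s≤s (s≤s z≤n))
    e01v : IsEdge G v0 v1 v
    e01v = lc v0 v1 v v1 v2 v e12v ((λ ()) , (λ ()) , (λ ())) z≤n (s≤s z≤n) ≤-refl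
    e02v : IsEdge G v0 v2 v
    e02v = lc v0 v2 v v1 v2 v e12v ((λ ()) , (λ ()) , (λ ())) z≤n ≤-refl ≤-refl

sorted-edge-through-0 : ∀ {t} (G : ThreeGraph t) → LeftCompressed G → K4Free G →
  (a b c : Vertex t) → Sorted (a , b , c) → (a , b , c) ∈ edges G →
  (a , b , c) ∈ triplesThrough0 t
sorted-edge-through-0 {suc n} G lc k4free fz (fs b) (fs c) (_ , s≤s b<c) _ =
  ∈-map⁺ (λ (b , c) → (fz , fs b , fs c)) (increasingPairs-complete n b c b<c)
sorted-edge-through-0 G lc k4free (fs a) b c (a<b , b<c) abc∈G =
  ⊥-elim (no-edge-avoiding-0 G lc k4free (fs a) b c (s≤s z≤n) 2≤b (≤-trans (s≤s 2≤b) b<c) (inj₁ abc∈G))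
  where
    2≤b : 2 ≤ toℕ b
    2≤b = ≤-trans (s≤s (s≤s z≤n)) a<b

edges-through-0 : ∀ {t} (G : ThreeGraph t) → LeftCompressed G → K4Free G →
  edges G ⊆ triplesThrough0 t
edges-through-0 G lc k4free {a , b , c} abc∈G =
  sorted-edge-through-0 G lc k4free a b c (All.lookup (sorted G) abc∈G) abc∈G

proposition1 : (t : ℕ) (G : ThreeGraph t) → LeftCompressed G → K4Free G →
    27 * numEdges G ≤ 2 * t ^ 3
proposition1 t G lc k4free = begin
  27 * numEdges G                ≤⟨ *-monoʳ-≤ 27 edges≤triples ⟩
  27 * length (triplesThrough0 t) ≤⟨ triplesThrough0-bound t ⟩
  2 * t ^ 3                      ∎
  where
    open ≤-Reasoning
    edges≤triples : numEdges G ≤ length (triplesThrough0 t)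
    edges≤triples = unique-⊆-length (edges G) (triplesThrough0 t) (unique G) (edges-through-0 G lc k4free)
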